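{- The principal Eratosthenes rays do not intersect: for any two distinct $a,b\in\overline{C}$ one has $r_a\cap r_b=\emptyset$. Moreover, the union of all rays with prime bases is contained in the union of the principal rays: \[ \bigcup_{p_0\in P} r_{p_0} \subset \bigcup_{p_0\in \overline{C}} r_{p_0}. \]
   Context: Let $P=\{2,3,5,7,\ldots\}$ be the set of primes, $p_1=2<p_2=3<\dots$ its elements in increasing order, and $\pi^{ -1}(n)=p_n$ the $n$-th prime. Let $\overline{C}=\mathbb{N}\setminus P=\{1,4,6,8,9,10,12,\ldots\}$ (the unit together with the composite numbers). For a natural number $p_0$, the Eratosthenes ray of base $p_0$ is $r_{p_0}=\{p_{k+1}: k=0,1,2,\ldots\}$ where $p_{k+1}=\pi^{ -1}(p_k)$. A ray $r_{p_0}$ with $p_0\in\overline{C}$ is called principal. -}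

module Defs where

open import Data.Nat using (ℕ; zero; suc; _≤_; _<_)
open import Data.Nat.Primality using (Prime; prime?)
open import Data.Product using (Σ; _×_; ∃)
open import Relation.Nullary using (¬_; does)
open import Data.Bool using (if_then_else_)
open import Relation.Binary.PropositionalEquality using (_≡_)

π : ℕ → ℕ
π zero = 0
π (suc n) = if does (prime? (suc n)) then suc (π n) else π n

-- NthPrime n p  :  p = π⁻¹(n), i.e. p is the n-th prime (p₁ = 2, p₂ = 3, …)
NthPrime : ℕ → ℕ → Set
NthPrime n p = Prime p × π p ≡ n

-- C̄ = ℕ \ P with ℕ = {1,2,3,…}: the unit together with the composites
C̄ : ℕ → Set
C̄ n = 1 ≤ n × ¬ Prime n

-- Iterate a k x : x = p_k in the sequence p₀ = a, p_{k+1} = π⁻¹(p_k)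
data Iterate (a : ℕ) : ℕ → ℕ → Set where
  base : Iterate a zero a
  step : ∀ {k x y} → Iterate a k x → NthPrime x y → Iterate a (suc k) y

-- x ∈ r_a  (the ray r_a = {p₁, p₂, …}, base p₀ = a excluded)
_∈Ray_ : ℕ → ℕ → Set
x ∈Ray a = Σ ℕ λ k → Iterate a (suc k) x

{-# OPTIONS --safe #-}
module Submission where

-- Every term of a ray after its base is prime, and its predecessor is recovered
-- as π of it; so a ray can be followed backwards uniquely until it reaches a
-- non-prime, which is the base of the unique principal ray through it. Since
-- π p < p for a prime p, this backward walk terminates.

open import Defs
open import Data.Nat using (ℕ; zero; suc; _+_; _≤_; _<_; z≤n; s≤s)
open import Data.Nat.Induction using (<-rec)
open import Data.Nat.Properties using (≤-refl; ≤-trans; n≤1+n)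
open import Data.Nat.Primality using (Prime; prime?; ¬prime[0])
open import Data.Product using (Σ; _×_; _,_)
open import Data.Bool using (true; false)
open import Relation.Nullary using (¬_; yes; no; does; contradiction)
open import Relation.Binary.PropositionalEquality using (_≡_; _≢_; refl)

π[1+n]≤1+π[n] : ∀ n → π (suc n) ≤ suc (π n)
π[1+n]≤1+π[n] n with does (prime? (suc n))
... | true  = ≤-refl
... | false = n≤1+n _

π[1+n]≤n : ∀ n → π (suc n) ≤ n
π[1+n]≤n zero    = z≤n
π[1+n]≤n (suc n) = ≤-trans (π[1+n]≤1+π[n] (suc n)) (s≤s (π[1+n]≤n n))

prime⇒π<id : ∀ {p} → Prime p → π p < p
prime⇒π<id {zero}  pp = contradiction pp ¬prime[0]
prime⇒π<id {suc n} _  = s≤s (π[1+n]≤n n)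

prime⇒1≤π : ∀ {p} → Prime p → 1 ≤ π p
prime⇒1≤π {zero}  pp = contradiction pp ¬prime[0]
prime⇒1≤π {suc n} pp with prime? (suc n)
... | yes _   = s≤s z≤n
... | no  ¬pp = contradiction pp ¬pp

Iterate-trans : ∀ {a b x m k} → Iterate a m b → Iterate b k x → Iterate a (k + m) x
Iterate-trans i base       = i
Iterate-trans i (step j q) = step (Iterate-trans i j) q

∈Ray-trans : ∀ {a b x} → b ∈Ray a → x ∈Ray b → x ∈Ray a
∈Ray-trans (m , i) (k , j) = k + suc m , Iterate-trans i j

prime⇒∈Ray-π : ∀ {p} → Prime p → p ∈Ray π p
prime⇒∈Ray-π pp = 0 , step base (pp , refl)

Iterate-base-unique : ∀ {a b k j x} → ¬ Prime a → ¬ Prime b →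
                      Iterate a k x → Iterate b j x → a ≡ b
Iterate-base-unique ¬pa ¬pb base              base              = refl
Iterate-base-unique ¬pa ¬pb base              (step _ (px , _)) = contradiction px ¬pa
Iterate-base-unique ¬pa ¬pb (step _ (px , _)) base              = contradiction px ¬pb
Iterate-base-unique ¬pa ¬pb (step i (_ , refl)) (step j (_ , refl)) =
  Iterate-base-unique ¬pa ¬pb i j

OnPrincipalRay : ℕ → Set
OnPrincipalRay x = Σ ℕ λ c → C̄ c × x ∈Ray c

prime⇒OnPrincipalRay : ∀ p → Prime p → OnPrincipalRay p
prime⇒OnPrincipalRay = <-rec (λ p → Prime p → OnPrincipalRay p) walkBack
  where
  walkBack : ∀ p → (∀ {q} → q < p → Prime q → OnPrincipalRay q) →
             Prime p → OnPrincipalRay p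
  walkBack p below pp with prime? (π p)
  ... | no  ¬pπ = π p , (prime⇒1≤π pp , ¬pπ) , prime⇒∈Ray-π pp
  ... | yes pπ  with below (prime⇒π<id pp) pπ
  ...   | c , c∈C̄ , π∈r = c , c∈C̄ , ∈Ray-trans π∈r (prime⇒∈Ray-π pp)

lemma3 : ((a b : ℕ) → C̄ a → C̄ b → a ≢ b → (x : ℕ) → x ∈Ray a → ¬ (x ∈Ray b))
           × ((p x : ℕ) → Prime p → x ∈Ray p → Σ ℕ λ c → C̄ c × x ∈Ray c)
lemma3 = disjoint , covered
  where
  disjoint : (a b : ℕ) → C̄ a → C̄ b → a ≢ b → (x : ℕ) → x ∈Ray a → ¬ (x ∈Ray b)
  disjoint a b (_ , ¬pa) (_ , ¬pb) a≢b x (_ , i) (_ , j) =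
    a≢b (Iterate-base-unique ¬pa ¬pb i j)

  covered : (p x : ℕ) → Prime p → x ∈Ray p → OnPrincipalRay x
  covered p x pp x∈r with prime⇒OnPrincipalRay p pp
  ... | c , c∈C̄ , p∈r = c , c∈C̄ , ∈Ray-trans p∈r x∈r
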